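{- Let $p,q,r$ be integers, $n\ge0$ an integer, and $x$ a number with $(1-x-x^2)(1+4x-x^2)\neq0$. Then $$\begin{aligned}\sum_{k=0}^n x^kG_{p+k}H_{q+k}K_{r-k}=\frac{1}{(1-x-x^2)(1+4x-x^2)}\Big\{&x^{n+1}\big[x^2(x-3)G_{p+n}H_{q+n}K_{r-n}-(3x+1)G_{p+n+1}H_{q+n+1}K_{r-n-1}\\&\quad+x^2G_{p+n-1}H_{q+n-1}K_{r-n+1}-xG_{p+n+2}H_{q+n+2}K_{r-n-2}\big]\\&-x^2(x-3)G_{p-1}H_{q-1}K_{r+1}+(3x+1)G_pH_qK_r\\&-x^2G_{p-2}H_{q-2}K_{r+2}+xG_{p+1}H_{q+1}K_{r-1}\Big\}.\end{aligned}$$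
   Context: $(G_n),(H_n),(K_n)$, indexed by all integers $n$, are generalized Fibonacci sequences: each satisfies $X_{n+2}=X_{n+1}+X_n$ for all integers $n$, with arbitrary initial values $X_0,X_1$. -}

module Defs where

open import Level using (Level)
open import Data.Nat using (ℕ)
import Data.Nat as ℕ
open import Data.Integer using (ℤ; +_)
import Data.Integer as ℤ
open import Algebra.Bundles using (CommutativeRing)

module _ {c ℓ : Level} (R : CommutativeRing c ℓ) where
  open CommutativeRing R

  pow : Carrier → ℕ → Carrier
  pow x ℕ.zero    = 1#
  pow x (ℕ.suc n) = x * pow x n

  sumTo : ℕ → (ℕ → Carrier) → Carrier
  sumTo ℕ.zero    f = f ℕ.zero
  sumTo (ℕ.suc n) f = sumTo n f + f (ℕ.suc n)

  IsGenFib : (ℤ → Carrier) → Set ℓ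
  IsGenFib X = ∀ (n : ℤ) → X (n ℤ.+ + 2) ≈ X (n ℤ.+ + 1) + X n

  two three four : Carrier
  two   = 1# + 1#
  three = two + 1#
  four  = three + 1#

{-# OPTIONS --safe #-}
module Submission where

open import Defs
open import Level using (Level)
open import Data.Nat using (ℕ)
import Data.Nat as ℕ
open import Data.Integer using (ℤ; +_)
import Data.Integer as ℤ
open import Algebra.Bundles using (CommutativeRing)

open import Data.Nat using (zero; suc)
import Data.Nat.Properties as ℕ
open import Data.Integer using (-[1+_]; _⊖_)
import Data.Integer.Properties as ℤ
open import Data.Integer.Tactic.RingSolver using (solve-∀)
open import Data.Maybe using (Maybe; map)
open import Relation.Binary.Consequences using (dec⇒weaklyDec)
open import Relation.Binary.PropositionalEquality using (_≡_; cong)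
import Relation.Binary.PropositionalEquality as ≡
import Algebra.Solver.Ring.AlmostCommutativeRing as ACR

-- The sequence T m = G (p + m) H (q + m) K (r − m) satisfies the order-4 recurrence whose
-- characteristic polynomial is (z² − z − 1)(z² + 4z − 1) = z⁴ + 3z³ − 6z² − 3z + 1,
-- the reciprocal of D(x) = (1 − x − x²)(1 + 4x − x²).  With the boundary form
-- B m = x²(x − 3) T m − (3x + 1) T (m + 1) + x² T (m − 1) − x T (m + 2), the recurrence
-- says exactly that D(x) xᵏ T k = xᵏ⁺¹ B k − xᵏ B (k − 1), so the sum telescopes.

fibFrom : ∀ {a} {A : Set a} → (A → A → A) → A → A → ℕ → A
fibFrom _∙_ u v zero          = u
fibFrom _∙_ u v (suc zero)    = v
fibFrom _∙_ u v (suc (suc j)) = fibFrom _∙_ u v (suc j) ∙ fibFrom _∙_ u v j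

-- Integer coefficients are needed because the identities involve subtraction.  The
-- optimised multiple _×_ of Mult.TCOptimised makes the coefficients 3 and 4 evaluate to
-- (1# + 1#) + 1# and ((1# + 1#) + 1#) + 1#, i.e. definitionally to three R and four R.
module IntegerCoefficients {c ℓ : Level} (R : CommutativeRing c ℓ) where
  open CommutativeRing R
  open import Algebra.Properties.Ring ring
  open import Algebra.Properties.CommutativeSemigroup +-commutativeSemigroup using (interchange)
  open import Algebra.Properties.Semiring.Mult.TCOptimised semiring
  open import Relation.Binary.Reasoning.Setoid setoid

  fromℤ : ℤ → Carrier
  fromℤ (+ n)    = n × 1#
  fromℤ -[1+ n ] = - (suc n × 1#)

  fromℤ-homo-neg : ∀ i → fromℤ (ℤ.- i) ≈ - fromℤ i
  fromℤ-homo-neg (+ zero)  = sym -0#≈0#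
  fromℤ-homo-neg (+ suc n) = refl
  fromℤ-homo-neg -[1+ n ]  = sym (-‿involutive _)

  [1+x]-[1+y]≈x-y : ∀ x y → (1# + x) - (1# + y) ≈ x - y
  [1+x]-[1+y]≈x-y x y = begin
    (1# + x) - (1# + y)       ≈⟨ +-congˡ (-‿+-comm 1# y) ⟨
    (1# + x) + (- 1# + - y)   ≈⟨ interchange 1# x (- 1#) (- y) ⟩
    (1# - 1#) + (x - y)       ≈⟨ +-congʳ (-‿inverseʳ 1#) ⟩
    0# + (x - y)              ≈⟨ +-identityˡ _ ⟩
    x - y                     ∎

  fromℤ-⊖ : ∀ m n → fromℤ (m ⊖ n) ≈ m × 1# - n × 1#
  fromℤ-⊖ m       zero    = sym (trans (+-congˡ -0#≈0#) (+-identityʳ _))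
  fromℤ-⊖ zero    (suc n) = sym (+-identityˡ _)
  fromℤ-⊖ (suc m) (suc n) = begin
    fromℤ (suc m ⊖ suc n)          ≡⟨ cong fromℤ (ℤ.[1+m]⊖[1+n]≡m⊖n m n) ⟩
    fromℤ (m ⊖ n)                  ≈⟨ fromℤ-⊖ m n ⟩
    m × 1# - n × 1#                ≈⟨ [1+x]-[1+y]≈x-y _ _ ⟨
    (1# + m × 1#) - (1# + n × 1#)  ≈⟨ +-cong (1+× m 1#) (-‿cong (1+× n 1#)) ⟨
    suc m × 1# - suc n × 1#        ∎

  fromℤ-homo-+ : ∀ i j → fromℤ (i ℤ.+ j) ≈ fromℤ i + fromℤ j
  fromℤ-homo-+ (+ m)    (+ n)    = ×-homo-+ 1# m n
  fromℤ-homo-+ (+ m)    -[1+ n ] = fromℤ-⊖ m (suc n)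
  fromℤ-homo-+ -[1+ m ] (+ n)    = trans (fromℤ-⊖ n (suc m)) (+-comm _ _)
  fromℤ-homo-+ -[1+ m ] -[1+ n ] = begin
    fromℤ (-[1+ m ] ℤ.+ -[1+ n ])        ≡⟨ cong fromℤ (ℤ.neg-distrib-+ (+ suc m) (+ suc n)) ⟨
    fromℤ (ℤ.- (+ suc m ℤ.+ + suc n))    ≈⟨ fromℤ-homo-neg (+ suc m ℤ.+ + suc n) ⟩
    - fromℤ (+ suc m ℤ.+ + suc n)        ≈⟨ -‿cong (×-homo-+ 1# (suc m) (suc n)) ⟩
    - (suc m × 1# + suc n × 1#)          ≈⟨ -‿+-comm _ _ ⟨
    fromℤ -[1+ m ] + fromℤ -[1+ n ]      ∎

  fromℤ-homo-*-+ : ∀ m j → fromℤ (+ m ℤ.* j) ≈ m × 1# * fromℤ j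
  fromℤ-homo-*-+ m (+ n) = trans (reflexive (cong fromℤ (≡.sym (ℤ.pos-* m n)))) (×1-homo-* m n)
  fromℤ-homo-*-+ m -[1+ n ] = begin
    fromℤ (+ m ℤ.* ℤ.- + suc n)        ≡⟨ cong fromℤ (ℤ.neg-distribʳ-* (+ m) (+ suc n)) ⟨
    fromℤ (ℤ.- (+ m ℤ.* + suc n))      ≈⟨ fromℤ-homo-neg (+ m ℤ.* + suc n) ⟩
    - fromℤ (+ m ℤ.* + suc n)          ≈⟨ -‿cong (fromℤ-homo-*-+ m (+ suc n)) ⟩
    - (m × 1# * suc n × 1#)            ≈⟨ -‿distribʳ-* _ _ ⟩
    m × 1# * fromℤ -[1+ n ]            ∎

  fromℤ-homo-* : ∀ i j → fromℤ (i ℤ.* j) ≈ fromℤ i * fromℤ j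
  fromℤ-homo-* (+ m)    j = fromℤ-homo-*-+ m j
  fromℤ-homo-* -[1+ m ] j = begin
    fromℤ (ℤ.- + suc m ℤ.* j)          ≡⟨ cong fromℤ (ℤ.neg-distribˡ-* (+ suc m) j) ⟨
    fromℤ (ℤ.- (+ suc m ℤ.* j))        ≈⟨ fromℤ-homo-neg (+ suc m ℤ.* j) ⟩
    - fromℤ (+ suc m ℤ.* j)            ≈⟨ -‿cong (fromℤ-homo-*-+ (suc m) j) ⟩
    - (suc m × 1# * fromℤ j)           ≈⟨ -‿distribˡ-* _ _ ⟩
    fromℤ -[1+ m ] * fromℤ j           ∎

  homomorphism : ℤ.+-*-rawRing ACR.-Raw-AlmostCommutative⟶ ACR.fromCommutativeRing R
  homomorphism = record
    { ⟦_⟧    = fromℤ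
    ; +-homo = fromℤ-homo-+
    ; *-homo = fromℤ-homo-*
    ; -‿homo = fromℤ-homo-neg
    ; 0-homo = refl
    ; 1-homo = refl
    }

  _≟-coefficient_ : ∀ i j → Maybe (fromℤ i ≈ fromℤ j)
  i ≟-coefficient j = map (λ { ≡.refl → refl }) (dec⇒weaklyDec ℤ._≟_ i j)

  open import Algebra.Solver.Ring ℤ.+-*-rawRing (ACR.fromCommutativeRing R) homomorphism _≟-coefficient_ public

module FibonacciProductSums {c ℓ : Level} (R : CommutativeRing c ℓ) where
  open CommutativeRing R hiding (zero)
  open IntegerCoefficients R
  open import Algebra.Properties.Ring ring using (x≈y⇒x∙y⁻¹≈ε; x[y-z]≈xy-xz)
  open import Algebra.Properties.CommutativeSemigroup *-commutativeSemigroup using (x∙yz≈y∙xz; x∙yz≈yx∙z)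
  open import Relation.Binary.Reasoning.Setoid setoid

  reindex : (X : ℤ → Carrier) {i j : ℤ} → i ≡ j → X i ≈ X j
  reindex X i≡j = reflexive (cong X i≡j)

  x*y*z*w≈x*[y*z*w] : ∀ x y z w → x * y * z * w ≈ x * (y * z * w)
  x*y*z*w≈x*[y*z*w] x y z w = trans (*-congʳ (*-assoc x y z)) (*-assoc x (y * z) w)

  sumTo-cong : ∀ n {f g : ℕ → Carrier} → (∀ k → f k ≈ g k) → sumTo R n f ≈ sumTo R n g
  sumTo-cong zero    f≈g = f≈g 0
  sumTo-cong (suc n) f≈g = +-cong (sumTo-cong n f≈g) (f≈g (suc n))

  *-distribˡ-sumTo : ∀ a n (f : ℕ → Carrier) → a * sumTo R n f ≈ sumTo R n (λ k → a * f k)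
  *-distribˡ-sumTo a zero    f = refl
  *-distribˡ-sumTo a (suc n) f = trans (distribˡ a _ _) (+-congʳ (*-distribˡ-sumTo a n f))

  sumTo-telescope : (f g : ℕ → Carrier) → (∀ k → f k ≈ g (suc k) - g k) →
                    ∀ n → sumTo R n f ≈ g (suc n) - g 0
  sumTo-telescope f g step zero    = step 0
  sumTo-telescope f g step (suc n) = begin
    sumTo R n f + f (suc n)                             ≈⟨ +-cong (sumTo-telescope f g step n) (step (suc n)) ⟩
    (g (suc n) - g 0) + (g (suc (suc n)) - g (suc n))   ≈⟨ cancel (g 0) (g (suc n)) (g (suc (suc n))) ⟩
    g (suc (suc n)) - g 0                               ∎
    where
    cancel : ∀ a b d → (b - a) + (d - b) ≈ d - a
    cancel = solve 3 (λ a b d → (b :- a) :+ (d :- b) := d :- a) refl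

  solve-by-inverse : ∀ {a a⁻¹ s t} → a⁻¹ * a ≈ 1# → a * s ≈ t → s ≈ a⁻¹ * t
  solve-by-inverse {a} {a⁻¹} {s} {t} inverse as≈t = begin
    s                ≈⟨ *-identityˡ s ⟨
    1# * s           ≈⟨ *-congʳ inverse ⟨
    a⁻¹ * a * s      ≈⟨ *-assoc a⁻¹ a s ⟩
    a⁻¹ * (a * s)    ≈⟨ *-congˡ as≈t ⟩
    a⁻¹ * t          ∎

  IsGenFib⇒fibFrom : ∀ {X} → IsGenFib R X → ∀ a j → X (a ℤ.+ + j) ≈ fibFrom _+_ (X a) (X (a ℤ.+ + 1)) j
  IsGenFib⇒fibFrom {X} fib a zero          = reindex X (ℤ.+-identityʳ a)
  IsGenFib⇒fibFrom {X} fib a (suc zero)    = refl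
  IsGenFib⇒fibFrom {X} fib a (suc (suc j)) = begin
    X (a ℤ.+ + (2 ℕ.+ j))                   ≡⟨ cong X (shift 2) ⟩
    X (a ℤ.+ + j ℤ.+ + 2)                   ≈⟨ fib (a ℤ.+ + j) ⟩
    X (a ℤ.+ + j ℤ.+ + 1) + X (a ℤ.+ + j)   ≡⟨ cong (λ i → X i + X (a ℤ.+ + j)) (shift 1) ⟨
    X (a ℤ.+ + suc j) + X (a ℤ.+ + j)       ≈⟨ +-cong (IsGenFib⇒fibFrom fib a (suc j)) (IsGenFib⇒fibFrom fib a j) ⟩
    fibFrom _+_ (X a) (X (a ℤ.+ + 1)) (suc (suc j)) ∎
    where
    shift : ∀ k → a ℤ.+ + (k ℕ.+ j) ≡ a ℤ.+ + j ℤ.+ + k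
    shift k = ≡.trans (cong (λ n → a ℤ.+ + n) (ℕ.+-comm k j)) (≡.sym (ℤ.+-assoc a (+ j) (+ k)))

  six : Carrier
  six = fromℤ (+ 6)

  ProductRecurrence : (ℤ → Carrier) → Set ℓ
  ProductRecurrence T =
    ∀ m → T (m ℤ.+ + 4) + three R * T (m ℤ.+ + 3) + T m ≈ six * T (m ℤ.+ + 2) + three R * T (m ℤ.+ + 1)

  fibProduct : (G H K : ℤ → Carrier) (p q r : ℤ) → ℤ → Carrier
  fibProduct G H K p q r m = G (p ℤ.+ m) * H (q ℤ.+ m) * K (r ℤ.- m)

  fibFrom-product-identity : ∀ g₀ g₁ h₀ h₁ k₀ k₁ →
    let g = fibFrom _+_ g₀ g₁; h = fibFrom _+_ h₀ h₁; k = fibFrom _+_ k₀ k₁ in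
    g 4 * h 4 * k 0 + three R * (g 3 * h 3 * k 1) + g 0 * h 0 * k 4
      ≈ six * (g 2 * h 2 * k 2) + three R * (g 1 * h 1 * k 3)
  fibFrom-product-identity = solve 6 (λ g₀ g₁ h₀ h₁ k₀ k₁ →
    let g = fibFrom _:+_ g₀ g₁; h = fibFrom _:+_ h₀ h₁; k = fibFrom _:+_ k₀ k₁ in
    g 4 :* h 4 :* k 0 :+ con (+ 3) :* (g 3 :* h 3 :* k 1) :+ g 0 :* h 0 :* k 4
      := con (+ 6) :* (g 2 :* h 2 :* k 2) :+ con (+ 3) :* (g 1 :* h 1 :* k 3)) refl

  -- All five terms are written through G p′, G (p′ + 1), H q′, H (q′ + 1), K r′, K (r′ + 1),
  -- which turns the recurrence into a polynomial identity in these six values.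
  fibProduct-recurrence : ∀ {G H K} → IsGenFib R G → IsGenFib R H → IsGenFib R K →
                          ∀ p q r → ProductRecurrence (fibProduct G H K p q r)
  fibProduct-recurrence {G} {H} {K} fibG fibH fibK p q r m =
    trans (+-cong (+-cong (value 4 0 ≡.refl) (*-congˡ (value 3 1 ≡.refl)))
                  (trans (reindex T (≡.sym (ℤ.+-identityʳ m))) (value 0 4 ≡.refl)))
   (trans (fibFrom-product-identity (G p′) (G (p′ ℤ.+ + 1)) (H q′) (H (q′ ℤ.+ + 1)) (K r′) (K (r′ ℤ.+ + 1)))
          (sym (+-cong (*-congˡ (value 2 2 ≡.refl)) (*-congˡ (value 1 3 ≡.refl)))))
    where
    T : ℤ → Carrier
    T = fibProduct G H K p q r
    p′ q′ r′ : ℤ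
    p′ = p ℤ.+ m
    q′ = q ℤ.+ m
    r′ = r ℤ.- (m ℤ.+ + 4)
    r-index : ∀ (s n j i : ℤ) → s ℤ.- (n ℤ.+ j) ≡ s ℤ.- (n ℤ.+ (j ℤ.+ i)) ℤ.+ i
    r-index = solve-∀
    value : ∀ j i → + j ℤ.+ + i ≡ + 4 →
            T (m ℤ.+ + j) ≈ fibFrom _+_ (G p′) (G (p′ ℤ.+ + 1)) j * fibFrom _+_ (H q′) (H (q′ ℤ.+ + 1)) j
                                                                  * fibFrom _+_ (K r′) (K (r′ ℤ.+ + 1)) i
    value j i j+i≡4 = *-cong (*-cong
      (trans (reindex G (≡.sym (ℤ.+-assoc p m (+ j)))) (IsGenFib⇒fibFrom fibG p′ j))
      (trans (reindex H (≡.sym (ℤ.+-assoc q m (+ j)))) (IsGenFib⇒fibFrom fibH q′ j)))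
      (trans (reindex K (≡.trans (r-index r m (+ j) (+ i)) (cong (λ s → r ℤ.- (m ℤ.+ s) ℤ.+ + i) j+i≡4)))
             (IsGenFib⇒fibFrom fibK r′ i))

  denominator : Carrier → Carrier
  denominator x = (1# - x - x * x) * (1# + four R * x - x * x)

  boundaryForm : (x t₋₁ t₀ t₁ t₂ : Carrier) → Carrier
  boundaryForm x t₋₁ t₀ t₁ t₂ = x * x * (x - three R) * t₀ - (three R * x + 1#) * t₁ + x * x * t₋₁ - x * t₂

  boundaryForm-cong : ∀ x {t₋₁ t₀ t₁ t₂ u₋₁ u₀ u₁ u₂} → t₋₁ ≈ u₋₁ → t₀ ≈ u₀ → t₁ ≈ u₁ → t₂ ≈ u₂ →
                      boundaryForm x t₋₁ t₀ t₁ t₂ ≈ boundaryForm x u₋₁ u₀ u₁ u₂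
  boundaryForm-cong x e₋₁ e₀ e₁ e₂ =
    +-cong (+-cong (+-cong (*-congˡ e₀) (-‿cong (*-congˡ e₁))) (*-congˡ e₋₁)) (-‿cong (*-congˡ e₂))

  boundary : Carrier → (ℤ → Carrier) → ℤ → Carrier
  boundary x T m = boundaryForm x (T (m ℤ.- + 1)) (T m) (T (m ℤ.+ + 1)) (T (m ℤ.+ + 2))

  boundaryForm-difference : ∀ x t₋₂ t₋₁ t₀ t₁ t₂ → t₂ + three R * t₁ + t₋₂ ≈ six * t₀ + three R * t₋₁ →
    denominator x * t₀ ≈ x * boundaryForm x t₋₁ t₀ t₁ t₂ - boundaryForm x t₋₂ t₋₁ t₀ t₁
  boundaryForm-difference x t₋₂ t₋₁ t₀ t₁ t₂ recurrence = begin
    denominator x * t₀                  ≈⟨ identity x t₋₂ t₋₁ t₀ t₁ t₂ ⟩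
    x * B₀ - B₋₁ + x * x * (t₂ + three R * t₁ + t₋₂ - (six * t₀ + three R * t₋₁))
                                        ≈⟨ +-congˡ (*-congˡ (x≈y⇒x∙y⁻¹≈ε recurrence)) ⟩
    x * B₀ - B₋₁ + x * x * 0#           ≈⟨ +-congˡ (zeroʳ (x * x)) ⟩
    x * B₀ - B₋₁ + 0#                   ≈⟨ +-identityʳ _ ⟩
    x * B₀ - B₋₁                        ∎
    where
    B₀ B₋₁ : Carrier
    B₀  = boundaryForm x t₋₁ t₀ t₁ t₂
    B₋₁ = boundaryForm x t₋₂ t₋₁ t₀ t₁
    identity : ∀ x t₋₂ t₋₁ t₀ t₁ t₂ →
      denominator x * t₀ ≈ x * boundaryForm x t₋₁ t₀ t₁ t₂ - boundaryForm x t₋₂ t₋₁ t₀ t₁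
                           + x * x * (t₂ + three R * t₁ + t₋₂ - (six * t₀ + three R * t₋₁))
    identity = solve 6 (λ x t₋₂ t₋₁ t₀ t₁ t₂ →
      let form = λ s₋₁ s₀ s₁ s₂ → x :* x :* (x :- con (+ 3)) :* s₀ :- (con (+ 3) :* x :+ con (+ 1)) :* s₁
                                    :+ x :* x :* s₋₁ :- x :* s₂ in
      (con (+ 1) :- x :- x :* x) :* (con (+ 1) :+ con (+ 4) :* x :- x :* x) :* t₀
        := x :* form t₋₁ t₀ t₁ t₂ :- form t₋₂ t₋₁ t₀ t₁
           :+ x :* x :* (t₂ :+ con (+ 3) :* t₁ :+ t₋₂ :- (con (+ 6) :* t₀ :+ con (+ 3) :* t₋₁))) refl

  boundary-difference : ∀ {T} → ProductRecurrence T → ∀ x m →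
                        denominator x * T m ≈ x * boundary x T m - boundary x T (m ℤ.- + 1)
  boundary-difference {T} recurrence x m =
    trans (boundaryForm-difference x (T (m ℤ.- + 1 ℤ.- + 1)) (T (m ℤ.- + 1)) (T m) (T (m ℤ.+ + 1)) (T (m ℤ.+ + 2))
                                   recurrence-at-m)
          (+-congˡ (-‿cong (boundaryForm-cong x refl refl
            (reindex T (≡.sym (≡.trans (shift₁ m (+ 1)) (ℤ.+-identityʳ m)))) (reindex T (≡.sym (shift₁ m (+ 2)))))))
    where
    shift₁ : ∀ (n i : ℤ) → n ℤ.- + 1 ℤ.+ i ≡ n ℤ.+ (i ℤ.- + 1)
    shift₁ = solve-∀
    shift₂ : ∀ (n i : ℤ) → n ℤ.- + 1 ℤ.- + 1 ℤ.+ i ≡ n ℤ.+ (i ℤ.- + 2)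
    shift₂ = solve-∀
    recurrence-at-m : T (m ℤ.+ + 2) + three R * T (m ℤ.+ + 1) + T (m ℤ.- + 1 ℤ.- + 1)
                        ≈ six * T m + three R * T (m ℤ.- + 1)
    recurrence-at-m = begin
      T (m ℤ.+ + 2) + three R * T (m ℤ.+ + 1) + T n
        ≈⟨ +-congʳ (+-cong (reindex T (shift₂ m (+ 4))) (*-congˡ (reindex T (shift₂ m (+ 3))))) ⟨
      T (n ℤ.+ + 4) + three R * T (n ℤ.+ + 3) + T n
        ≈⟨ recurrence n ⟩
      six * T (n ℤ.+ + 2) + three R * T (n ℤ.+ + 1)
        ≈⟨ +-cong (*-congˡ (reindex T (≡.trans (shift₂ m (+ 2)) (ℤ.+-identityʳ m))))
                  (*-congˡ (reindex T (shift₂ m (+ 1)))) ⟩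
      six * T m + three R * T (m ℤ.- + 1) ∎
      where
      n : ℤ
      n = m ℤ.- + 1 ℤ.- + 1

  weightedSum : ∀ {T} → ProductRecurrence T → ∀ x n →
    denominator x * sumTo R n (λ k → pow R x k * T (+ k))
      ≈ pow R x (suc n) * boundary x T (+ n) - boundary x T -[1+ 0 ]
  weightedSum {T} recurrence x n = begin
    denominator x * sumTo R n (λ k → pow R x k * T (+ k))    ≈⟨ *-distribˡ-sumTo (denominator x) n _ ⟩
    sumTo R n (λ k → denominator x * (pow R x k * T (+ k)))  ≈⟨ sumTo-telescope _ g step n ⟩
    g (suc n) - g 0                                          ≈⟨ +-cong (*-congˡ (B-suc n)) (-‿cong (*-identityˡ _)) ⟩
    pow R x (suc n) * boundary x T (+ n) - boundary x T -[1+ 0 ] ∎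
    where
    B : ℤ → Carrier
    B = boundary x T
    g : ℕ → Carrier
    g k = pow R x k * B (+ k ℤ.- + 1)
    B-suc : ∀ k → B (+ suc k ℤ.- + 1) ≈ B (+ k)
    B-suc k = reindex B (ℤ.[1+m]⊖[1+n]≡m⊖n k 0)
    step : ∀ k → denominator x * (pow R x k * T (+ k)) ≈ g (suc k) - g k
    step k = begin
      denominator x * (pow R x k * T (+ k))           ≈⟨ x∙yz≈y∙xz _ _ _ ⟩
      pow R x k * (denominator x * T (+ k))           ≈⟨ *-congˡ (boundary-difference recurrence x (+ k)) ⟩
      pow R x k * (x * B (+ k) - B (+ k ℤ.- + 1))     ≈⟨ x[y-z]≈xy-xz _ _ _ ⟩
      pow R x k * (x * B (+ k)) - g k                 ≈⟨ +-congʳ (x∙yz≈yx∙z _ _ _) ⟩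
      pow R x (suc k) * B (+ k) - g k                 ≈⟨ +-congʳ (*-congˡ (B-suc k)) ⟨
      g (suc k) - g k                                 ∎

  fibProduct-boundaries : ∀ (G H K : ℤ → Carrier) (p q r : ℤ) (n : ℕ) (x y : Carrier) →
    let T = fibProduct G H K p q r in
    y * (x * x * (x - three R) * G (p ℤ.+ + n) * H (q ℤ.+ + n) * K (r ℤ.- + n)
         - (three R * x + 1#) * G (p ℤ.+ + n ℤ.+ + 1) * H (q ℤ.+ + n ℤ.+ + 1) * K (r ℤ.- + n ℤ.- + 1)
         + x * x * G (p ℤ.+ + n ℤ.- + 1) * H (q ℤ.+ + n ℤ.- + 1) * K (r ℤ.- + n ℤ.+ + 1)
         - x * G (p ℤ.+ + n ℤ.+ + 2) * H (q ℤ.+ + n ℤ.+ + 2) * K (r ℤ.- + n ℤ.- + 2))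
    - x * x * (x - three R) * G (p ℤ.- + 1) * H (q ℤ.- + 1) * K (r ℤ.+ + 1)
    + (three R * x + 1#) * G p * H q * K r
    - x * x * G (p ℤ.- + 2) * H (q ℤ.- + 2) * K (r ℤ.+ + 2)
    + x * G (p ℤ.+ + 1) * H (q ℤ.+ + 1) * K (r ℤ.- + 1)
      ≈ y * boundary x T (+ n) - boundary x T -[1+ 0 ]
  fibProduct-boundaries G H K p q r n x y = trans
    (+-cong (+-cong (+-cong (+-cong
      (*-congˡ (+-cong (+-cong (+-cong
        (term _ (+ n) ≡.refl ≡.refl ≡.refl)
        (-‿cong (term _ (+ n ℤ.+ + 1) (assoc p) (assoc q) (minus-assoc r (+ n) (+ 1)))))
        (term _ (+ n ℤ.- + 1) (assoc p) (assoc q) (minus-assoc r (+ n) (ℤ.- + 1))))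
        (-‿cong (term _ (+ n ℤ.+ + 2) (assoc p) (assoc q) (minus-assoc r (+ n) (+ 2))))))
      (-‿cong (term _ -[1+ 0 ] ≡.refl ≡.refl ≡.refl)))
      (term _ (+ 0) (≡.sym (ℤ.+-identityʳ p)) (≡.sym (ℤ.+-identityʳ q)) (≡.sym (ℤ.+-identityʳ r))))
      (-‿cong (term _ -[1+ 1 ] ≡.refl ≡.refl ≡.refl)))
      (term _ (+ 1) ≡.refl ≡.refl ≡.refl))
    (rearrange _ _ _ _ _)
    where
    T : ℤ → Carrier
    T = fibProduct G H K p q r
    term : ∀ a m {i j l} → i ≡ p ℤ.+ m → j ≡ q ℤ.+ m → l ≡ r ℤ.- m → a * G i * H j * K l ≈ a * T m
    term a m ≡.refl ≡.refl ≡.refl = x*y*z*w≈x*[y*z*w] a _ _ _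
    assoc : ∀ s {d} → s ℤ.+ + n ℤ.+ d ≡ s ℤ.+ (+ n ℤ.+ d)
    assoc s {d} = ℤ.+-assoc s (+ n) d
    minus-assoc : ∀ (s m d : ℤ) → s ℤ.- m ℤ.- d ≡ s ℤ.- (m ℤ.+ d)
    minus-assoc = solve-∀
    rearrange : ∀ a b c d e → a - b + c - d + e ≈ a - (b - c + d - e)
    rearrange = solve 5 (λ a b c d e → a :- b :+ c :- d :+ e := a :- (b :- c :+ d :- e)) refl

mainTheorem8 : ∀ {c ℓ : Level} (R : CommutativeRing c ℓ) →
    let open CommutativeRing R in
    (G H K : ℤ → Carrier) → IsGenFib R G → IsGenFib R H → IsGenFib R K →
    (p q r : ℤ) (n : ℕ) (x : Carrier) →
    (Dinv : Carrier) →
    Dinv * ((1# - x - x * x) * (1# + four R * x - x * x)) ≈ 1# →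
    sumTo R n (λ k → pow R x k * G (p ℤ.+ + k) * H (q ℤ.+ + k) * K (r ℤ.- + k))
      ≈ Dinv * (pow R x (ℕ.suc n) * (x * x * (x - three R) * G (p ℤ.+ + n) * H (q ℤ.+ + n) * K (r ℤ.- + n)
                                     - (three R * x + 1#) * G (p ℤ.+ + n ℤ.+ + 1) * H (q ℤ.+ + n ℤ.+ + 1) * K (r ℤ.- + n ℤ.- + 1)
                                     + x * x * G (p ℤ.+ + n ℤ.- + 1) * H (q ℤ.+ + n ℤ.- + 1) * K (r ℤ.- + n ℤ.+ + 1)
                                     - x * G (p ℤ.+ + n ℤ.+ + 2) * H (q ℤ.+ + n ℤ.+ + 2) * K (r ℤ.- + n ℤ.- + 2))
                 - x * x * (x - three R) * G (p ℤ.- + 1) * H (q ℤ.- + 1) * K (r ℤ.+ + 1)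
                 + (three R * x + 1#) * G p * H q * K r
                 - x * x * G (p ℤ.- + 2) * H (q ℤ.- + 2) * K (r ℤ.+ + 2)
                 + x * G (p ℤ.+ + 1) * H (q ℤ.+ + 1) * K (r ℤ.- + 1))
mainTheorem8 R G H K fibG fibH fibK p q r n x Dinv inverse = begin
  sumTo R n (λ k → pow R x k * G (p ℤ.+ + k) * H (q ℤ.+ + k) * K (r ℤ.- + k))
    ≈⟨ sumTo-cong n (λ k → x*y*z*w≈x*[y*z*w] _ _ _ _) ⟩
  sumTo R n (λ k → pow R x k * T (+ k))
    ≈⟨ solve-by-inverse inverse (weightedSum (fibProduct-recurrence fibG fibH fibK p q r) x n) ⟩
  Dinv * (pow R x (suc n) * boundary x T (+ n) - boundary x T -[1+ 0 ])
    ≈⟨ *-congˡ (fibProduct-boundaries G H K p q r n x (pow R x (suc n))) ⟨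
  _ ∎
  where
  open CommutativeRing R hiding (zero)
  open FibonacciProductSums R
  open import Relation.Binary.Reasoning.Setoid setoid
  T : ℤ → Carrier
  T = fibProduct G H K p q r
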